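{- There exists an equivariant simplicial map $t\colon \mathrm{Hom}(K_2,K_4)\to\Sigma^2$.
   Context: A multihomomorphism $m\colon K_2\to G$ is a pair of nonempty subsets $m(1),m(2)\subseteq V(G)$ with $m(1)\times m(2)\subseteq E(G)$; multihomomorphisms are partially ordered by componentwise inclusion. $\mathrm{Hom}(K_2,G)$ is the order complex of this poset: the simplicial set whose $n$-simplices are weakly increasing chains $[m_0\le\dots\le m_n]$, with face/degeneracy operations given by omitting/repeating entries in order. It carries the $\mathbb Z_2$-action swapping $m(1)$ and $m(2)$. $\Sigma^2$ is the simplicial set whose vertices are two colours, blue and yellow, and whose $n$-simplices are all $(n+1)$-tuples of colours with at most $2$ alternations between consecutive entries; its $\mathbb Z_2$-action swaps the two colours. A simplicial map between such simplicial sets is a vertex map sending simplices to simplices; it is equivariant if it commutes with the actions. $K_k$ is the complete loopless graph on $k$ vertices. -}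

module Defs where

open import Data.Nat using (ℕ; zero; suc; _≤_; _+_)
open import Data.Fin using (Fin)
open import Data.Fin.Subset using (Subset; _∈_; _⊆_; Nonempty)
open import Data.Bool using (Bool; true; false; not; if_then_else_)
open import Data.Vec using (Vec; []; _∷_; map)
open import Data.Product using (_×_)
open import Data.Unit using (⊤)
open import Relation.Binary.PropositionalEquality using (_≡_; _≢_; sym)
open import Relation.Nullary using (Dec; yes; no; does)
open import Data.Bool using (_≟_)

record Graph : Set₁ where
  field
    size    : ℕ
    Adj     : Fin size → Fin size → Set
    Adj-sym : ∀ {a b} → Adj a b → Adj b a
open Graph public

K : ℕ → Graph
K k = record { size = k ; Adj = λ a b → a ≢ b ; Adj-sym = λ p q → p (sym q) }

-- Multihomomorphism K₂ → G: nonempty m(1), m(2) ⊆ V(G) with m(1) × m(2) ⊆ E(G).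
-- These are the vertices (0-simplices) of Hom(K₂,G).
record MultiHom (G : Graph) : Set where
  constructor mh
  field
    m₁ : Subset (size G)
    m₂ : Subset (size G)
    m₁-nonempty : Nonempty m₁
    m₂-nonempty : Nonempty m₂
    edges : ∀ a b → a ∈ m₁ → b ∈ m₂ → Adj G a b
open MultiHom public

_≼_ : ∀ {G} → MultiHom G → MultiHom G → Set
m ≼ m' = (m₁ m ⊆ m₁ m') × (m₂ m ⊆ m₂ m')

-- Z₂-action on Hom(K₂,G): swap m(1) and m(2).
swap : ∀ {G} → MultiHom G → MultiHom G
swap {G} (mh a b na nb e) = mh b a nb na (λ x y x∈b y∈a → Adj-sym G (e y x y∈a x∈b))

-- n-simplices of Hom(K₂,G): weakly increasing chains m₀ ≼ … ≼ mₙ.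
IsChain : ∀ {G n} → Vec (MultiHom G) n → Set
IsChain []               = ⊤
IsChain (m ∷ [])         = ⊤
IsChain (m ∷ m' ∷ ms)    = (m ≼ m') × IsChain (m' ∷ ms)

-- Σ²: vertices are two colours (Bool: true = blue, false = yellow);
-- Z₂-action is `not`.
Colour : Set
Colour = Bool

alternations : ∀ {n} → Vec Colour n → ℕ
alternations []            = 0
alternations (c ∷ [])      = 0
alternations (c ∷ c' ∷ cs) =
  (if does (c ≟ c') then 0 else 1) + alternations (c' ∷ cs)

-- n-simplices of Σ²: (n+1)-tuples with at most 2 alternations.
IsΣ²Simplex : ∀ {n} → Vec Colour n → Set
IsΣ²Simplex cs = alternations cs ≤ 2

IsSimplicialToΣ² : ∀ {G} → (MultiHom G → Colour) → Set
IsSimplicialToΣ² {G} t =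
  ∀ (n : ℕ) (σ : Vec (MultiHom G) (suc n)) → IsChain σ → IsΣ²Simplex (map t σ)

IsEquivariant : ∀ {G} → (MultiHom G → Colour) → Set
IsEquivariant t = ∀ m → t (swap m) ≡ not (t m)

{-# OPTIONS --safe #-}

-- Colour a multihomomorphism m blue when the least vertex of m(1) ∪ m(2) lies
-- in m(1). In K_n the sets m(1) and m(2) are disjoint, so swapping them swaps
-- the colour. Along a chain m ≼ m' the rank |m(1)| + |m(2)| weakly increases,
-- and if it stays the same then m = m', so the colour can only alternate where
-- the rank strictly increases. Since the rank lies between 2 and n, a chain
-- sees at most n − 2 alternations.
module Submission where

open import Defs
open import Data.Bool using (Bool; true; false; not; if_then_else_; _≟_)
open import Data.Fin.Subset using (Subset; _∈_; _∉_; _⊆_; Nonempty; ∣_∣; ⁅_⁆; ∁)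
open import Data.Fin.Subset.Properties
  using (drop-∷-⊆; drop-there; p⊆q⇒∣p∣≤∣q∣; ∣p∣≤n; ∣∁p∣≡n∸∣p∣; x∉p⇒x∈∁p; ∣⁅x⁆∣≡1; x∈⁅y⁆⇒x≡y)
open import Data.Fin.Base using (zero; suc)
open import Data.Nat.Base using (ℕ; suc; _+_; _∸_; _≤_; _<_; z≤n; s≤s)
open import Data.Nat.Properties
  using (≤-refl; ≤-trans; +-mono-≤; +-monoˡ-≤; +-monoʳ-≤; +-mono-<-≤; +-mono-≤-<;
         +-comm; +-assoc; +-cancelʳ-≤; m+[n∸m]≡n; module ≤-Reasoning)
open import Data.Product.Base using (Σ; _×_; _,_)
open import Data.Sum.Base using (_⊎_; inj₁; inj₂)
import Data.Sum.Base as Sum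
open import Data.Vec.Base using (Vec; []; _∷_; map; last; here; there)
open import Function.Base using (id)
open import Relation.Binary.PropositionalEquality using (_≡_; refl; sym; cong; cong₂; subst)
open import Relation.Nullary using (does; contradiction)

private
  variable
    n n' : ℕ
    p q : Subset n
    G : Graph

Disjoint : Subset n → Subset n → Set
Disjoint p q = ∀ {x} → x ∈ p → x ∉ q

nonempty⇒1≤∣p∣ : Nonempty p → 1 ≤ ∣ p ∣
nonempty⇒1≤∣p∣ {p = p} (x , x∈p) = subst (_≤ ∣ p ∣) (∣⁅x⁆∣≡1 x) (p⊆q⇒∣p∣≤∣q∣ ⁅x⁆⊆p)
  where
  ⁅x⁆⊆p : ⁅ x ⁆ ⊆ p
  ⁅x⁆⊆p y∈⁅x⁆ = subst (_∈ p) (sym (x∈⁅y⁆⇒x≡y x y∈⁅x⁆)) x∈p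

disjoint⇒∣p∣+∣q∣≤n : {p q : Subset n} → Disjoint p q → ∣ p ∣ + ∣ q ∣ ≤ n
disjoint⇒∣p∣+∣q∣≤n {n} {p} {q} p#q = begin
  ∣ p ∣ + ∣ q ∣        ≤⟨ +-monoʳ-≤ ∣ p ∣ (p⊆q⇒∣p∣≤∣q∣ q⊆∁p) ⟩
  ∣ p ∣ + ∣ ∁ p ∣      ≡⟨ cong (∣ p ∣ +_) (∣∁p∣≡n∸∣p∣ p) ⟩
  ∣ p ∣ + (n ∸ ∣ p ∣)  ≡⟨ m+[n∸m]≡n (∣p∣≤n p) ⟩
  n                    ∎
  where
  open ≤-Reasoning
  q⊆∁p : q ⊆ ∁ p
  q⊆∁p x∈q = x∉p⇒x∈∁p (λ x∈p → p#q x∈p x∈q)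

⊆⇒≡⊎∣p∣<∣q∣ : p ⊆ q → p ≡ q ⊎ ∣ p ∣ < ∣ q ∣
⊆⇒≡⊎∣p∣<∣q∣ {p = []}        {[]}        p⊆q = inj₁ refl
⊆⇒≡⊎∣p∣<∣q∣ {p = true ∷ p}  {true ∷ q}  p⊆q = Sum.map (cong (true ∷_)) s≤s (⊆⇒≡⊎∣p∣<∣q∣ (drop-∷-⊆ p⊆q))
⊆⇒≡⊎∣p∣<∣q∣ {p = true ∷ p}  {false ∷ q} p⊆q with p⊆q here
... | ()
⊆⇒≡⊎∣p∣<∣q∣ {p = false ∷ p} {true ∷ q}  p⊆q = inj₂ (s≤s (p⊆q⇒∣p∣≤∣q∣ (drop-∷-⊆ p⊆q)))
⊆⇒≡⊎∣p∣<∣q∣ {p = false ∷ p} {false ∷ q} p⊆q = Sum.map (cong (false ∷_)) id (⊆⇒≡⊎∣p∣<∣q∣ (drop-∷-⊆ p⊆q))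

-- junk value true when p and q are both empty
minInLeft : Subset n → Subset n → Bool
minInLeft []          []          = true
minInLeft (true ∷ _)  _           = true
minInLeft (false ∷ _) (true ∷ _)  = false
minInLeft (false ∷ p) (false ∷ q) = minInLeft p q

minInLeft-swap : Nonempty p → Disjoint p q → minInLeft q p ≡ not (minInLeft p q)
minInLeft-swap {p = true ∷ _}  {true ∷ _}  _ p#q = contradiction here (p#q here)
minInLeft-swap {p = true ∷ _}  {false ∷ _} _ _   = refl
minInLeft-swap {p = false ∷ _} {true ∷ _}  _ _   = refl
minInLeft-swap {p = false ∷ _} {false ∷ _} (suc x , x∈p) p#q =
  minInLeft-swap (x , drop-there x∈p) (λ y∈p y∈q → p#q (there y∈p) (there y∈q))

colour : MultiHom G → Colour
colour m = minInLeft (m₁ m) (m₂ m)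

rank : MultiHom G → ℕ
rank m = ∣ m₁ m ∣ + ∣ m₂ m ∣

2≤rank : (m : MultiHom G) → 2 ≤ rank m
2≤rank m = +-mono-≤ (nonempty⇒1≤∣p∣ (m₁-nonempty m)) (nonempty⇒1≤∣p∣ (m₂-nonempty m))

edges-disjoint : (m : MultiHom (K n)) → Disjoint (m₁ m) (m₂ m)
edges-disjoint m x∈m₁ x∈m₂ = edges m _ _ x∈m₁ x∈m₂ refl

rank≤n : (m : MultiHom (K n)) → rank m ≤ n
rank≤n m = disjoint⇒∣p∣+∣q∣≤n (edges-disjoint m)

colour-swap : IsEquivariant {K n} colour
colour-swap m = minInLeft-swap (m₁-nonempty m) (edges-disjoint m)

≼⇒rank≤ : {m m' : MultiHom G} → m ≼ m' → rank m ≤ rank m'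
≼⇒rank≤ (m₁⊆ , m₂⊆) = +-mono-≤ (p⊆q⇒∣p∣≤∣q∣ m₁⊆) (p⊆q⇒∣p∣≤∣q∣ m₂⊆)

≼⇒colour≡⊎rank< : {m m' : MultiHom G} → m ≼ m' → colour m ≡ colour m' ⊎ rank m < rank m'
≼⇒colour≡⊎rank< (m₁⊆ , m₂⊆) with ⊆⇒≡⊎∣p∣<∣q∣ m₁⊆ | ⊆⇒≡⊎∣p∣<∣q∣ m₂⊆
... | inj₁ m₁≡ | inj₁ m₂≡ = inj₁ (cong₂ minInLeft m₁≡ m₂≡)
... | inj₂ m₁< | _        = inj₂ (+-mono-<-≤ m₁< (p⊆q⇒∣p∣≤∣q∣ m₂⊆))
... | inj₁ _   | inj₂ m₂< = inj₂ (+-mono-≤-< (p⊆q⇒∣p∣≤∣q∣ m₁⊆) m₂<)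

alternation : Colour → Colour → ℕ
alternation c c' = if does (c ≟ c') then 0 else 1

alternation-≡ : {c c' : Colour} → c ≡ c' → alternation c c' ≡ 0
alternation-≡ {true}  refl = refl
alternation-≡ {false} refl = refl

alternation≤1 : (c c' : Colour) → alternation c c' ≤ 1
alternation≤1 c c' with does (c ≟ c')
... | true  = z≤n
... | false = ≤-refl

alternation+rank≤rank : {m m' : MultiHom G} → m ≼ m' →
                        alternation (colour m) (colour m') + rank m ≤ rank m'
alternation+rank≤rank {m = m} {m'} m≼m' with ≼⇒colour≡⊎rank< {m = m} {m'} m≼m'
... | inj₁ c≡c' = subst (λ a → a + rank m ≤ rank m') (sym (alternation-≡ c≡c')) (≼⇒rank≤ {m = m} {m'} m≼m')
... | inj₂ r<r' = ≤-trans (+-monoˡ-≤ (rank m) (alternation≤1 (colour m) (colour m'))) r<r'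

chain⇒alternations+rank≤rank-last : (m : MultiHom G) (ms : Vec (MultiHom G) n) → IsChain (m ∷ ms) →
  alternations (map colour (m ∷ ms)) + rank m ≤ rank (last (m ∷ ms))
chain⇒alternations+rank≤rank-last m []         _              = ≤-refl
chain⇒alternations+rank≤rank-last m (m' ∷ ms) (m≼m' , chain) = begin
  (a + A) + rank m  ≡⟨ cong (_+ rank m) (+-comm a A) ⟩
  (A + a) + rank m  ≡⟨ +-assoc A a (rank m) ⟩
  A + (a + rank m)  ≤⟨ +-monoʳ-≤ A (alternation+rank≤rank {m = m} {m'} m≼m') ⟩
  A + rank m'       ≤⟨ chain⇒alternations+rank≤rank-last m' ms chain ⟩
  rank (last (m' ∷ ms)) ∎
  where
  open ≤-Reasoning
  a = alternation (colour m) (colour m')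
  A = alternations (map colour (m' ∷ ms))

chain⇒alternations+2≤n : (σ : Vec (MultiHom (K n)) (suc n')) → IsChain σ →
                         alternations (map colour σ) + 2 ≤ n
chain⇒alternations+2≤n (m ∷ ms) chain = begin
  alternations (map colour (m ∷ ms)) + 2       ≤⟨ +-monoʳ-≤ _ (2≤rank m) ⟩
  alternations (map colour (m ∷ ms)) + rank m  ≤⟨ chain⇒alternations+rank≤rank-last m ms chain ⟩
  rank (last (m ∷ ms))                         ≤⟨ rank≤n (last (m ∷ ms)) ⟩
  _                                            ∎
  where open ≤-Reasoning

lemma2p11 : Σ (MultiHom (K 4) → Colour) (λ t → IsSimplicialToΣ² t × IsEquivariant t)
lemma2p11 = colour , simplicial , colour-swap
  where
  simplicial : IsSimplicialToΣ² colour
  simplicial _ σ chain = +-cancelʳ-≤ 2 _ 2 (chain⇒alternations+2≤n σ chain)
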